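{- Let $R$ be a linear template (over a finite relational vocabulary $\sigma$ of maximum arity $n$), $A$ a finite $\sigma$-structure, and $k \ge n$. If there is no homomorphism $A \to R$, then $\mathrm{AvN}_R(\bar{S}_k)$ holds.
   Context: A linear template is a $\sigma$-structure whose universe is a finite commutative ring $R$ with unit, in which each $m$-ary relation symbol $E$ of $\sigma$ is interpreted as $\{(r_1,\ldots,r_m) \in R^m : \sum_{i=1}^m a_i r_i = b\}$ for some $\mathbf a \in R^m$, $b\in R$. Structures are identified with universes. $S_k(A)$ is the poset of subsets of $A$ of size at most $k$ (induced substructures), $M_k(A)$ its set of maximal elements. $H_k : S_k(A)^{op}\to\mathbf{Set}$ sends $C$ to the set of homomorphisms $C\to R$, with restriction of functions as restriction maps; $\bar S_k$ is its largest subpresheaf whose restriction maps are all surjective. For $C\in M_k(A)$, an equation $\sum_{i=1}^m c_i x_i = d$ with $x_1,\ldots,x_m\in C$, $\mathbf c \in R^m$, $d \in R$ is satisfied by $\bar S_k(C)$ if every $s \in \bar S_k(C)$ satisfies $\sum_i c_i s(x_i) = d$ in $R$ (no corresponding relation symbol is required). $T_C$ is the set of all equations satisfied by $\bar S_k(C)$, and $T_S = \bigcup_{C\in M_k(A)} T_C$. $\mathrm{AvN}_R(\bar S_k)$ (All-versus-Nothing contextuality) holds if there is no function $f : A\to R$ satisfying all equations in $T_S$ (i.e. $\sum_i c_i f(x_i) = d$ for each). -}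

module Defs where

open import Level using (0ℓ; suc)
open import Data.Nat using (ℕ; zero; _≤_; _⊔_)
open import Data.Fin using (Fin)
open import Data.Fin.Subset using (Subset; _∈_; _⊆_; ∣_∣)
open import Data.Product using (Σ; ∃; _×_; _,_)
open import Data.List using (foldr; allFin)
open import Relation.Nullary using (¬_)
open import Algebra.Bundles using (CommutativeRing)

record Vocabulary : Set where
  field
    nsym  : ℕ
    arity : Fin nsym → ℕ

open Vocabulary public

maxArity : Vocabulary → ℕ
maxArity σ = foldr (λ E m → arity σ E ⊔ m) 0 (allFin (nsym σ))

record Structure (σ : Vocabulary) : Set₁ where
  field
    size : ℕ
    rel  : (E : Fin (nsym σ)) → (Fin (arity σ E) → Fin size) → Set

open Structure public

module RingSum (R : CommutativeRing 0ℓ 0ℓ) where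
  open CommutativeRing R
  ∑ : ∀ {m} → (Fin m → Carrier) → Carrier
  ∑ {zero}  f = 0#
  ∑ {ℕ.suc m} f = f Fin.zero + ∑ (λ i → f (Fin.suc i))

IsFiniteRing : CommutativeRing 0ℓ 0ℓ → Set
IsFiniteRing R = Σ ℕ λ q → Σ (Fin q → Carrier) λ e → ∀ r → ∃ λ i → e i ≈ r
  where open CommutativeRing R

-- A linear template: a finite commutative ring with unit R, and for each
-- relation symbol E of arity m, a ∈ R^m and b ∈ R, so that
-- E^R = { r ∈ R^m : ∑ a_i r_i = b }.
record LinearTemplate (σ : Vocabulary) : Set₁ where
  field
    cring  : CommutativeRing 0ℓ 0ℓ
    finite : IsFiniteRing cring
  open CommutativeRing cring public hiding (ring)
  field
    coeff  : (E : Fin (nsym σ)) → Fin (arity σ E) → Carrier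
    const  : (E : Fin (nsym σ)) → Carrier

module _ {σ : Vocabulary} (T : LinearTemplate σ) (A : Structure σ) where
  open LinearTemplate T
  open RingSum cring

  private
    N = size A

  InRel : (E : Fin (nsym σ)) → (Fin (arity σ E) → Carrier) → Set
  InRel E r = ∑ (λ i → coeff E i * r i) ≈ const E

  IsHomAR : (Fin N → Carrier) → Set
  IsHomAR f = ∀ E (t : Fin (arity σ E) → Fin N) → rel A E t → InRel E (λ i → f (t i))

  InSk : ℕ → Subset N → Set
  InSk k C = ∣ C ∣ ≤ k

  InMk : ℕ → Subset N → Set
  InMk k C = InSk k C × (∀ C' → InSk k C' → C ⊆ C' → C' ⊆ C)

  Sec : Subset N → Set
  Sec C = (x : Fin N) → x ∈ C → Carrier

  _≐_ : ∀ {C} → Sec C → Sec C → Set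
  s ≐ t = ∀ x p → s x p ≈ t x p

  restrict : ∀ {C C'} → C' ⊆ C → Sec C → Sec C'
  restrict inc s x p = s x (inc p)

  IsHom : (C : Subset N) → Sec C → Set
  IsHom C s = ∀ E (t : Fin (arity σ E) → Fin N) → rel A E t →
              (p : ∀ i → t i ∈ C) → InRel E (λ i → s (t i) (p i))

  IsSurjSubpresheaf : ℕ → ((C : Subset N) → Sec C → Set) → Set
  IsSurjSubpresheaf k P =
      (∀ C s → InSk k C → P C s → IsHom C s)
    × (∀ C s t → InSk k C → P C s → s ≐ t → P C t)
    × (∀ C C' (inc : C' ⊆ C) s → InSk k C → InSk k C' → P C s → P C' (restrict inc s))
    × (∀ C C' (inc : C' ⊆ C) s → InSk k C → InSk k C' → P C' s →
         ∃ λ t → P C t × restrict inc t ≐ s)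

  -- S̄_k(C): the largest such subpresheaf, i.e. the union of all of them
  -- (the union of surjective subpresheaves is again one, hence the largest).
  InSbar : ℕ → (C : Subset N) → Sec C → Set₁
  InSbar k C s = ∃ λ (P : (C : Subset N) → Sec C → Set) → IsSurjSubpresheaf k P × P C s

  record Equation (C : Subset N) : Set where
    field
      len  : ℕ
      var  : Fin len → Fin N
      varC : ∀ i → var i ∈ C
      cs   : Fin len → Carrier
      d    : Carrier

  SatisfiedBySbar : ℕ → (C : Subset N) → Equation C → Set₁
  SatisfiedBySbar k C e = ∀ s → InSbar k C s →
    ∑ (λ i → Equation.cs e i * s (Equation.var e i) (Equation.varC e i)) ≈ Equation.d e

  SatisfiesTS : ℕ → (Fin N → Carrier) → Set₁
  SatisfiesTS k f = ∀ C → InMk k C → (e : Equation C) → SatisfiedBySbar k C e →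
    ∑ (λ i → Equation.cs e i * f (Equation.var e i)) ≈ Equation.d e

  AvN : ℕ → Set₁
  AvN k = ¬ (∃ λ (f : Fin N → Carrier) → SatisfiesTS k f)

-- Contrapositively, a solution f of T_S is a homomorphism A → R.  A tuple t of a
-- relation E^A spans at most arity(E) ≤ k elements, so it lies inside some
-- C ∈ M_k(A).  Every section in S̄_k(C) is a homomorphism on C, hence satisfies
-- the defining equation of E^R at t; that equation therefore belongs to T_C, and
-- f satisfies it.
module Submission where

open import Defs
open import Data.Nat using (ℕ; _≤_)
open import Data.Product using (∃)
open import Relation.Nullary using (¬_)

open import Data.Nat using (zero; suc; _+_; _∸_; _⊔_; _<_; _≤?_; s≤s)
open import Data.Nat.Properties
  using (≤-trans; ≤-reflexive; +-mono-≤; +-monoʳ-≤; +-suc; n≤1+n; m≤m⊔n; m≤n⊔m; ∸-monoʳ-<)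
open import Data.Nat.Induction using (<-wellFounded)
open import Induction.WellFounded using (Acc; acc)
open import Data.Fin using (Fin)
open import Data.Fin.Subset using (Subset; _∈_; _⊆_; _⊂_; _∪_; ⁅_⁆; ∣_∣; ⊥; inside; outside)
open import Data.Fin.Subset.Properties
  using (_∈?_; _⊂?_; anySubset?; ∣⊥∣≡0; ∣⁅x⁆∣≡1; x∈⁅x⁆; p⊆p∪q; q⊆p∪q; p⊂q⇒p⊆q; p⊂q⇒∣p∣<∣q∣)
open import Data.Vec using ([]; _∷_)
open import Data.List using (List; _∷_; foldr)
open import Data.List.Membership.Propositional using () renaming (_∈_ to _∈ˡ_)
open import Data.List.Membership.Propositional.Properties using (∈-allFin)
open import Data.List.Relation.Unary.Any using (here; there)
open import Data.Product using (_×_; _,_)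
open import Data.Empty using (⊥-elim)
open import Relation.Nullary using (yes; no)
open import Relation.Nullary.Decidable using (_×-dec_)
open import Relation.Binary.PropositionalEquality using (refl; sym)

≤-foldr-⊔ : ∀ {A : Set} (g : A → ℕ) {x} {xs : List A} → x ∈ˡ xs →
            g x ≤ foldr (λ y m → g y ⊔ m) 0 xs
≤-foldr-⊔ g {xs = y ∷ _} (here refl) = m≤m⊔n (g y) _
≤-foldr-⊔ g {xs = y ∷ _} (there x∈xs) = ≤-trans (≤-foldr-⊔ g x∈xs) (m≤n⊔m (g y) _)

arity≤maxArity : ∀ σ E → arity σ E ≤ maxArity σ
arity≤maxArity σ E = ≤-foldr-⊔ (arity σ) (∈-allFin E)

∣p∪q∣≤∣p∣+∣q∣ : ∀ {n} (p q : Subset n) → ∣ p ∪ q ∣ ≤ ∣ p ∣ + ∣ q ∣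
∣p∪q∣≤∣p∣+∣q∣ []              []              = ≤-reflexive refl
∣p∪q∣≤∣p∣+∣q∣ (inside ∷ p)  (inside ∷ q)  =
  s≤s (≤-trans (∣p∪q∣≤∣p∣+∣q∣ p q) (+-monoʳ-≤ ∣ p ∣ (n≤1+n ∣ q ∣)))
∣p∪q∣≤∣p∣+∣q∣ (inside ∷ p)  (outside ∷ q) = s≤s (∣p∪q∣≤∣p∣+∣q∣ p q)
∣p∪q∣≤∣p∣+∣q∣ (outside ∷ p) (inside ∷ q)  =
  ≤-trans (s≤s (∣p∪q∣≤∣p∣+∣q∣ p q)) (≤-reflexive (sym (+-suc ∣ p ∣ ∣ q ∣)))
∣p∪q∣≤∣p∣+∣q∣ (outside ∷ p) (outside ∷ q) = ∣p∪q∣≤∣p∣+∣q∣ p q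

image : ∀ {m n} → (Fin m → Fin n) → Subset n
image {zero}  t = ⊥
image {suc m} t = ⁅ t Fin.zero ⁆ ∪ image (λ i → t (Fin.suc i))

∈-image : ∀ {m n} (t : Fin m → Fin n) i → t i ∈ image t
∈-image {suc m} t Fin.zero    = p⊆p∪q _ (x∈⁅x⁆ (t Fin.zero))
∈-image {suc m} t (Fin.suc i) = q⊆p∪q ⁅ t Fin.zero ⁆ _ (∈-image (λ j → t (Fin.suc j)) i)

∣image∣≤ : ∀ {m n} (t : Fin m → Fin n) → ∣ image t ∣ ≤ m
∣image∣≤ {zero}  {n} t = ≤-reflexive (∣⊥∣≡0 n)
∣image∣≤ {suc m}     t =
  ≤-trans (∣p∪q∣≤∣p∣+∣q∣ ⁅ t Fin.zero ⁆ _)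
          (+-mono-≤ (≤-reflexive (∣⁅x⁆∣≡1 (t Fin.zero))) (∣image∣≤ (λ i → t (Fin.suc i))))

⊆∧⊄⇒⊇ : ∀ {n} {p q : Subset n} → p ⊆ q → ¬ p ⊂ q → q ⊆ p
⊆∧⊄⇒⊇ {p = p} p⊆q p⊄q {x} x∈q with x ∈? p
... | yes x∈p = x∈p
... | no  x∉p = ⊥-elim (p⊄q (p⊆q , x , x∈q , x∉p))

module _ {n : ℕ} (k : ℕ) where

  -- Definitionally InMk R A k for any R and any A with universe Fin n.
  Maximal≤ : Subset n → Set
  Maximal≤ C = ∣ C ∣ ≤ k × (∀ C' → ∣ C' ∣ ≤ k → C ⊆ C' → C' ⊆ C)

  ⊆-maximal≤ : ∀ D → ∣ D ∣ ≤ k → ∃ λ C → D ⊆ C × Maximal≤ C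
  ⊆-maximal≤ D D≤k = extend D D≤k (<-wellFounded (k ∸ ∣ D ∣))
    where
    extend : ∀ D → ∣ D ∣ ≤ k → Acc _<_ (k ∸ ∣ D ∣) → ∃ λ C → D ⊆ C × Maximal≤ C
    extend D D≤k (acc smaller) with anySubset? (λ C' → (∣ C' ∣ ≤? k) ×-dec (D ⊂? C'))
    ... | yes (C' , C'≤k , D⊂C') =
      let C , C'⊆C , maximalC = extend C' C'≤k (smaller (∸-monoʳ-< (p⊂q⇒∣p∣<∣q∣ D⊂C') C'≤k))
      in C , (λ x∈D → C'⊆C (p⊂q⇒p⊆q D⊂C' x∈D)) , maximalC
    ... | no noLargerSuperset =
      D , (λ x∈D → x∈D) , D≤k ,
      λ C' C'≤k D⊆C' → ⊆∧⊄⇒⊇ D⊆C' (λ D⊂C' → noLargerSuperset (C' , C'≤k , D⊂C'))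

module _ {σ : Vocabulary} (R : LinearTemplate σ) (A : Structure σ) where
  open LinearTemplate R

  relationEquation : ∀ {C} E (t : Fin (arity σ E) → Fin (size A)) → (∀ i → t i ∈ C) →
                     Equation R A C
  relationEquation E t t∈C =
    record { len = arity σ E ; var = t ; varC = t∈C ; cs = coeff E ; d = const E }

  Sbar-satisfies-relationEquation :
    ∀ k C → InSk R A k C → ∀ E t → rel A E t → (t∈C : ∀ i → t i ∈ C) →
    SatisfiedBySbar R A k C (relationEquation E t t∈C)
  Sbar-satisfies-relationEquation k C C≤k E t tᴬ t∈C s (P , (P⊆H , _) , Ps) =
    P⊆H C s C≤k Ps E t tᴬ t∈C

proposition13p1 : (σ : Vocabulary) (R : LinearTemplate σ) (A : Structure σ) (k : ℕ) →
    maxArity σ ≤ k →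
    ¬ (∃ λ f → IsHomAR R A f) →
    AvN R A k
proposition13p1 σ R A k maxArity≤k noHom (f , f⊨TS) = noHom (f , f-hom)
  where
  f-hom : IsHomAR R A f
  f-hom E t tᴬ =
    let image≤k = ≤-trans (∣image∣≤ t) (≤-trans (arity≤maxArity σ E) maxArity≤k)
        C , image⊆C , maximalC@(C≤k , _) = ⊆-maximal≤ k (image t) image≤k
        t∈C = λ i → image⊆C (∈-image t i)
    in f⊨TS C maximalC (relationEquation R A E t t∈C)
            (Sbar-satisfies-relationEquation R A k C C≤k E t tᴬ t∈C)
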